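{- Let $T$ be a tree belonging to $\mathcal G^0\cup\{1\}$. Then for every admissible cut $\boldsymbol v$ of $T$, $Roo_{\boldsymbol v}(T)\in\mathcal G^0\cup\{1\}$.
   Context: An ordered forest of degree $n\ge 0$ is a planar rooted forest with $n$ vertices (a left-to-right sequence of rooted trees, the children of each vertex linearly ordered from left to right) together with a bijection from its vertex set to $\{1,\dots,n\}$ (labels); edges point towards roots. $1$ is the empty forest, $\bullet_1$ the one-vertex tree. Admissible cuts: for an ordered forest $F$, a subset $\boldsymbol v$ of its vertex set is an admissible cut if no two distinct elements of $\boldsymbol v$ are joined by a directed path. $Lea_{\boldsymbol v}(F)$ is the subforest formed by the vertices $w$ whose path to the root passes through an element of $\boldsymbol v$ (elements of $\boldsymbol v$ included), and $Roo_{\boldsymbol v}(F)$ is the subforest formed by the remaining vertices; both inherit the planar structure and are relabelled by the unique increasing bijection of their sets of labels onto $\{1,\dots,k\}$. For $n\ge1$ and $\underline\varepsilon=(\varepsilon_1,\dots,\varepsilon_n)\in\{+,-\}^n$ define sets $\mathcal G^{(\underline\varepsilon)}$ of ordered forests of degree $n$ recursively: $\mathcal G^{(\varepsilon_1)}=\{\bullet_1\}$; for $n\ge2$, let $F'$ range over $\mathcal G^{(\varepsilon_1,\dots,\varepsilon_{n-1})}$ with trees $T_1,\dots,T_m$ from left to right; all vertices of $F'$ keep their labels and a new vertex labelled $n$ is added. If $\varepsilon_n=-$: add a new root whose children are the roots of $T_1,\dots,T_m$ in order. If $\varepsilon_n=+$: either add the new vertex as a one-vertex tree at the right end, or, for some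 $1\le i\le m$, attach the new vertex as rightmost child of the root of $T_i$ and make the roots of $T_{i+1},\dots,T_m$ (in order) the children of the new vertex. $\mathcal G^0=\bigcup_{n\ge1}\mathcal G^{(+,\dots,+)}$ (words of length $n$ consisting only of $+$). -}

module Defs where

open import Data.Nat using (ℕ; zero; suc; _<?_; _≥_)
open import Data.Bool using (Bool; true; false; if_then_else_)
open import Data.List using (List; []; _∷_; _++_; _∷ʳ_; length; filter; concat; replicate)
open import Data.Sum using (_⊎_)
open import Data.Product using (Σ; _×_; ∃)
open import Relation.Binary.PropositionalEquality using (_≡_; _≢_)
open import Relation.Nullary using (¬_)

-- Planar labelled trees / forests: a vertex carries its label and the
-- left-to-right list of its children; a forest is a left-to-right list of trees.
data Tree : Set where
  node : ℕ → List Tree → Tree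

Forest : Set
Forest = List Tree

mutual
  labelsT : Tree → List ℕ
  labelsT (node l cs) = l ∷ labelsF cs

  labelsF : Forest → List ℕ
  labelsF [] = []
  labelsF (t ∷ ts) = labelsT t ++ labelsF ts

mutual
  data _∈T_ : ℕ → Tree → Set where
    here  : ∀ {l cs} → l ∈T node l cs
    below : ∀ {l l' cs} → l ∈F cs → l ∈T node l' cs

  data _∈F_ : ℕ → Forest → Set where
    hd : ∀ {l t ts} → l ∈T t → l ∈F (t ∷ ts)
    tl : ∀ {l t ts} → l ∈F ts → l ∈F (t ∷ ts)

mutual
  data SubT : Tree → Tree → Set where
    self : ∀ {t} → SubT t t
    deep : ∀ {s l cs} → SubF s cs → SubT s (node l cs)

  data SubF : Tree → Forest → Set where
    hd : ∀ {s t ts} → SubT s t → SubF s (t ∷ ts)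
    tl : ∀ {s t ts} → SubF s ts → SubF s (t ∷ ts)

-- there is a directed path (of positive length) from vertex b to vertex a
-- (edges point towards roots), i.e. a is a proper ancestor of b in F
Ancestor : Forest → ℕ → ℕ → Set
Ancestor F a b = Σ Forest (λ cs → SubF (node a cs) F × b ∈F cs)

Admissible : Forest → (ℕ → Bool) → Set
Admissible F v = ∀ a b → a ≢ b → v a ≡ true → v b ≡ true → ¬ Ancestor F a b

-- Roo_v(F) before relabelling: remove every vertex whose path to the root
-- passes through an element of v
mutual
  rooT : (ℕ → Bool) → Tree → Forest
  rooT v (node l cs) = if v l then [] else node l (rooF v cs) ∷ []

  rooF : (ℕ → Bool) → Forest → Forest
  rooF v [] = []
  rooF v (t ∷ ts) = rooT v t ++ rooF v ts

-- standardisation: the unique increasing bijection of the label set onto {1..k}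
rank : List ℕ → ℕ → ℕ
rank ls l = suc (length (filter (_<? l) ls))

mutual
  mapLabT : (ℕ → ℕ) → Tree → Tree
  mapLabT f (node l cs) = node (f l) (mapLabF f cs)

  mapLabF : (ℕ → ℕ) → Forest → Forest
  mapLabF f [] = []
  mapLabF f (t ∷ ts) = mapLabT f t ∷ mapLabF f ts

standardise : Forest → Forest
standardise F = mapLabF (rank (labelsF F)) F

Roo : (ℕ → Bool) → Forest → Forest
Roo v F = standardise (rooF v F)

data Sign : Set where
  plus minus : Sign

-- G ws F : F ∈ G^(ws), where ws = (ε₁,…,εₙ) is read left to right
data G : List Sign → Forest → Set where
  base   : ∀ ε → G (ε ∷ []) (node 1 [] ∷ [])
  minusS : ∀ {ws F} → G ws F →
           G (ws ∷ʳ minus) (node (suc (length ws)) F ∷ [])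
  plusNew : ∀ {ws F} → G ws F →
           G (ws ∷ʳ plus) (F ++ node (suc (length ws)) [] ∷ [])
  plusAttach : ∀ {ws} (pre : Forest) (r : ℕ) (cs post : Forest) →
           G ws (pre ++ node r cs ∷ post) →
           G (ws ∷ʳ plus) (pre ++ node r (cs ∷ʳ node (suc (length ws)) post) ∷ [])

G⁰ : Forest → Set
G⁰ F = Σ ℕ (λ n → n ≥ 1 × G (replicate n plus) F)

G⁰∪1 : Forest → Set
G⁰∪1 F = F ≡ [] ⊎ G⁰ F

-- A forest of G⁰ is grown by repeatedly adding a vertex whose label exceeds all
-- earlier ones, either as a new rightmost root or grafted as rightmost child of
-- some root, adopting all roots to its right.  Cutting away the vertices below v
-- undoes such a step in one of three ways: the new vertex survives (the step is
-- replayed on the smaller forest), it is cut together with the roots it adopted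
-- (leaving an initial segment of the trees of the earlier forest), or its whole
-- tree is cut.  Forests grown from increasing labels are closed under initial
-- segments, and standardisation only sees the relative order of the labels.
module Submission where

open import Defs
open import Data.Bool using (Bool; true; false)
open import Data.List using (List; []; _∷_; _++_; _∷ʳ_; length; filter; replicate)
open import Data.List.Properties
  using (++-assoc; ++-identityʳ; ++-conicalʳ; length-++; length-replicate;
         filter-all; filter-++; filter-reject; ∷-injectiveˡ; ∷-injectiveʳ)
open import Data.List.Relation.Unary.All as All using (All; []; _∷_)
open import Data.List.Relation.Unary.All.Properties using (++⁺; ++⁻ˡ; ++⁻ʳ; ∷ʳ⁺; replicate⁺)
open import Data.List.Relation.Binary.Sublist.Propositional using (_⊆_; _∷_; minimum)
open import Data.List.Relation.Binary.Sublist.Propositional.Properties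
  using (All-resp-⊆) renaming (++⁺ to ++⁺-⊆)
open import Data.Nat using (ℕ; suc; _<_; _≤_; _<?_; s≤s; z≤n)
open import Data.Nat.Properties using (<⇒≤; ≤⇒≯; +-suc; +-comm; ≤-refl; m≤n⇒m≤1+n)
open import Data.Product using (Σ; _×_; _,_; proj₁)
open import Data.Sum using (_⊎_; inj₁; inj₂)
open import Function using (case_of_)
open import Relation.Binary.PropositionalEquality
  using (_≡_; refl; sym; trans; cong; cong₂; subst; subst₂; module ≡-Reasoning)

length-∷ʳ : ∀ {X : Set} (xs : List X) x → length (xs ∷ʳ x) ≡ suc (length xs)
length-∷ʳ xs x = trans (length-++ xs) (+-comm (length xs) 1)

All-insert : ∀ {P : ℕ → Set} A B {n} → All P (A ++ B) → P n → All P (A ++ n ∷ B)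
All-insert A B ps pn = ++⁺ (++⁻ˡ A ps) (pn ∷ ++⁻ʳ A ps)

∷ʳ≡++-cases : ∀ {A : Set} (xs ys zs : List A) x → xs ∷ʳ x ≡ ys ++ zs →
  zs ≡ [] ⊎ Σ (List A) (λ zs′ → xs ≡ ys ++ zs′)
∷ʳ≡++-cases xs [] zs x eq = inj₂ (xs , refl)
∷ʳ≡++-cases [] (y ∷ []) [] x refl = inj₁ refl
∷ʳ≡++-cases (w ∷ xs) (y ∷ ys) zs x eq with ∷ʳ≡++-cases xs ys zs x (∷-injectiveʳ eq)
... | inj₁ zs≡[]         = inj₁ zs≡[]
... | inj₂ (zs′ , xs≡)   = inj₂ (zs′ , cong₂ _∷_ (∷-injectiveˡ eq) xs≡)

length-insert : ∀ {X : Set} {L₀ L : List X} {n} A B → L₀ ≡ A ++ B → L ≡ A ++ n ∷ B → length L ≡ suc (length L₀)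
length-insert A B refl refl = trans (length-++ A) (trans (+-suc (length A) (length B)) (cong suc (sym (length-++ A))))

replicate-suc-∷ʳ : ∀ {X : Set} k (x : X) → replicate (suc k) x ≡ replicate k x ∷ʳ x
replicate-suc-∷ʳ 0 x = refl
replicate-suc-∷ʳ (suc k) x = cong (x ∷_) (replicate-suc-∷ʳ k x)

rank-insert-max : ∀ {L₀ L n} A B → L₀ ≡ A ++ B → L ≡ A ++ n ∷ B → All (_< n) L₀ →
  All (λ l → rank L l ≡ rank L₀ l) L₀ × rank L n ≡ suc (length L₀)
rank-insert-max {n = n} A B refl refl lt =
  All.map (λ l<n → cong suc (count-insert (<⇒≤ l<n))) lt ,
  cong suc (begin
    length (filter (_<? n) (A ++ n ∷ B)) ≡⟨ count-insert ≤-refl ⟩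
    length (filter (_<? n) (A ++ B))     ≡⟨ cong length (filter-all (_<? n) lt) ⟩
    length (A ++ B)                      ∎)
  where
  open ≡-Reasoning
  count-insert : ∀ {l} → l ≤ n → length (filter (_<? l) (A ++ n ∷ B)) ≡ length (filter (_<? l) (A ++ B))
  count-insert {l} l≤n = cong length (begin
    filter (_<? l) (A ++ n ∷ B)                   ≡⟨ filter-++ (_<? l) A (n ∷ B) ⟩
    filter (_<? l) A ++ filter (_<? l) (n ∷ B)    ≡⟨ cong (filter (_<? l) A ++_) (filter-reject (_<? l) (≤⇒≯ l≤n)) ⟩
    filter (_<? l) A ++ filter (_<? l) B          ≡⟨ sym (filter-++ (_<? l) A B) ⟩
    filter (_<? l) (A ++ B)                       ∎)

labelsF-++ : ∀ A B → labelsF (A ++ B) ≡ labelsF A ++ labelsF B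
labelsF-++ [] B = refl
labelsF-++ (t ∷ A) B = trans (cong (labelsT t ++_) (labelsF-++ A B))
                             (sym (++-assoc (labelsT t) (labelsF A) (labelsF B)))

labelsF-∷ʳ : ∀ F t → labelsF (F ∷ʳ t) ≡ labelsF F ++ labelsT t
labelsF-∷ʳ F t = trans (labelsF-++ F (t ∷ [])) (cong (labelsF F ++_) (++-identityʳ (labelsT t)))

labelsF-split : ∀ pre r cs post →
  labelsF (pre ++ node r cs ∷ post) ≡ (labelsF pre ++ r ∷ labelsF cs) ++ labelsF post
labelsF-split pre r cs post = trans (labelsF-++ pre (node r cs ∷ post))
  (sym (++-assoc (labelsF pre) (r ∷ labelsF cs) (labelsF post)))

labelsF-graft : ∀ pre r cs n post →
  labelsF (pre ∷ʳ node r (cs ∷ʳ node n post)) ≡ (labelsF pre ++ r ∷ labelsF cs) ++ n ∷ labelsF post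
labelsF-graft pre r cs n post = begin
  labelsF (pre ∷ʳ node r (cs ∷ʳ node n post))        ≡⟨ labelsF-∷ʳ pre _ ⟩
  labelsF pre ++ r ∷ labelsF (cs ∷ʳ node n post)      ≡⟨ cong (λ ls → labelsF pre ++ r ∷ ls) (labelsF-∷ʳ cs _) ⟩
  labelsF pre ++ r ∷ labelsF cs ++ n ∷ labelsF post   ≡⟨ sym (++-assoc (labelsF pre) (r ∷ labelsF cs) _) ⟩
  (labelsF pre ++ r ∷ labelsF cs) ++ n ∷ labelsF post ∎
  where open ≡-Reasoning

All-labelsF-split : ∀ {P : ℕ → Set} pre r cs post → All P (labelsF (pre ++ node r cs ∷ post)) →
  All P (labelsF pre) × P r × All P (labelsF cs) × All P (labelsF post)
All-labelsF-split pre r cs post ps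
  with ps′ ← subst (All _) (labelsF-++ pre (node r cs ∷ post)) ps
  with ++⁻ˡ (labelsF pre) ps′ | ++⁻ʳ (labelsF pre) ps′
... | ps-pre | pr ∷ ps-rest = ps-pre , pr , ++⁻ˡ (labelsF cs) ps-rest , ++⁻ʳ (labelsF cs) ps-rest

rooF-++ : ∀ v A B → rooF v (A ++ B) ≡ rooF v A ++ rooF v B
rooF-++ v [] B = refl
rooF-++ v (t ∷ A) B = trans (cong (rooT v t ++_) (rooF-++ v A B)) (sym (++-assoc (rooT v t) _ _))

rooF-∷ʳ : ∀ v F t → rooF v (F ∷ʳ t) ≡ rooF v F ++ rooT v t
rooF-∷ʳ v F t = trans (rooF-++ v F (t ∷ [])) (cong (rooF v F ++_) (++-identityʳ (rooT v t)))

mutual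
  labelsF-rooT-⊆ : ∀ v t → labelsF (rooT v t) ⊆ labelsT t
  labelsF-rooT-⊆ v (node l cs) with v l
  ... | true  = minimum _
  ... | false = refl ∷ subst (_⊆ labelsF cs) (sym (++-identityʳ _)) (labelsF-rooF-⊆ v cs)

  labelsF-rooF-⊆ : ∀ v F → labelsF (rooF v F) ⊆ labelsF F
  labelsF-rooF-⊆ v [] = minimum _
  labelsF-rooF-⊆ v (t ∷ ts) = subst (_⊆ labelsT t ++ labelsF ts) (sym (labelsF-++ (rooT v t) (rooF v ts)))
    (++⁺-⊆ (labelsF-rooT-⊆ v t) (labelsF-rooF-⊆ v ts))

mapLabF-++ : ∀ f A B → mapLabF f (A ++ B) ≡ mapLabF f A ++ mapLabF f B
mapLabF-++ f [] B = refl
mapLabF-++ f (t ∷ A) B = cong (mapLabT f t ∷_) (mapLabF-++ f A B)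

mutual
  mapLabT-cong : ∀ {f g} t → All (λ l → f l ≡ g l) (labelsT t) → mapLabT f t ≡ mapLabT g t
  mapLabT-cong (node l cs) (p ∷ ps) = cong₂ node p (mapLabF-cong cs ps)

  mapLabF-cong : ∀ {f g} F → All (λ l → f l ≡ g l) (labelsF F) → mapLabF f F ≡ mapLabF g F
  mapLabF-cong [] ps = refl
  mapLabF-cong (t ∷ ts) ps = cong₂ _∷_ (mapLabT-cong t (++⁻ˡ (labelsT t) ps)) (mapLabF-cong ts (++⁻ʳ (labelsT t) ps))

mapLabF-graft : ∀ f pre r cs n post →
  mapLabF f (pre ∷ʳ node r (cs ∷ʳ node n post)) ≡ mapLabF f pre ∷ʳ node (f r) (mapLabF f cs ∷ʳ node (f n) (mapLabF f post))
mapLabF-graft f pre r cs n post =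
  trans (mapLabF-++ f pre _) (cong (λ cs′ → mapLabF f pre ∷ʳ node (f r) cs′) (mapLabF-++ f cs _))

-- A forest in G⁰, but with arbitrary increasing labels in place of 1, …, n
data Grown : Forest → Set where
  empty  : Grown []
  sprout : ∀ {F} n → All (_< n) (labelsF F) → Grown F → Grown (F ∷ʳ node n [])
  graft  : ∀ pre r cs post n → All (_< n) (labelsF (pre ++ node r cs ∷ post)) →
           Grown (pre ++ node r cs ∷ post) → Grown (pre ∷ʳ node r (cs ∷ʳ node n post))

G-plus⇒Grown : ∀ {ws F} → G ws F → All (_≡ plus) ws → Grown F × All (_≤ length ws) (labelsF F)
G-plus⇒Grown (base _) _ = sprout 1 [] empty , s≤s z≤n ∷ []
G-plus⇒Grown (minusS {ws} _) ps with ++⁻ʳ ws ps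
... | () ∷ _
G-plus⇒Grown (plusNew {ws} {F} g) ps with G-plus⇒Grown g (++⁻ˡ ws ps)
... | gF , bound rewrite length-∷ʳ ws plus | labelsF-∷ʳ F (node (suc (length ws)) []) =
  sprout _ (All.map s≤s bound) gF , ∷ʳ⁺ (All.map m≤n⇒m≤1+n bound) ≤-refl
G-plus⇒Grown (plusAttach {ws} pre r cs post g) ps with G-plus⇒Grown g (++⁻ˡ ws ps)
... | gF , bound rewrite length-∷ʳ ws plus | labelsF-graft pre r cs (suc (length ws)) post =
  graft pre r cs post _ (All.map s≤s bound) gF ,
  All-insert _ (labelsF post) (subst (All _) (labelsF-split pre r cs post) (All.map m≤n⇒m≤1+n bound)) ≤-refl

Grown-++⁻ˡ : ∀ {F} → Grown F → ∀ A B → F ≡ A ++ B → Grown A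
Grown-++⁻ˡ empty [] B eq = empty
Grown-++⁻ˡ (sprout {F} n lt g) A B eq with ∷ʳ≡++-cases F A B _ eq
... | inj₁ refl = subst Grown (trans eq (++-identityʳ A)) (sprout n lt g)
... | inj₂ (B′ , F≡) = Grown-++⁻ˡ g A B′ F≡
Grown-++⁻ˡ (graft pre r cs post n lt g) A B eq with ∷ʳ≡++-cases pre A B _ eq
... | inj₁ refl = subst Grown (trans eq (++-identityʳ A)) (graft pre r cs post n lt g)
... | inj₂ (B′ , refl) = Grown-++⁻ˡ g A (B′ ++ node r cs ∷ post) (++-assoc A B′ _)

Grown-rooF : ∀ v {F} → Grown F → Grown (rooF v F)
Grown-rooF v empty = empty
Grown-rooF v (sprout {F} n lt g) rewrite rooF-∷ʳ v F (node n []) with v n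
... | true  = subst Grown (sym (++-identityʳ _)) (Grown-rooF v g)
... | false = sprout n (All-resp-⊆ (labelsF-rooF-⊆ v F) lt) (Grown-rooF v g)
Grown-rooF v (graft pre r cs post n lt g)
  with Grown-rooF v g | All-resp-⊆ (labelsF-rooF-⊆ v (pre ++ node r cs ∷ post)) lt
... | ih | lt′ rewrite rooF-∷ʳ v pre (node r (cs ∷ʳ node n post)) | rooF-++ v pre (node r cs ∷ post) with v r
... | true  = subst Grown (sym (++-identityʳ _)) (Grown-++⁻ˡ ih (rooF v pre) (rooF v post) refl)
... | false rewrite rooF-∷ʳ v cs (node n post) with v n
... | true  = subst Grown (cong (λ cs′ → rooF v pre ∷ʳ node r cs′) (sym (++-identityʳ _)))
                (Grown-++⁻ˡ ih (rooF v pre ∷ʳ node r (rooF v cs)) (rooF v post) (sym (++-assoc (rooF v pre) _ _)))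
... | false = graft (rooF v pre) r (rooF v cs) (rooF v post) n lt′ ih

standardise-sprout : ∀ F n → All (_< n) (labelsF F) →
  standardise (F ∷ʳ node n []) ≡ standardise F ∷ʳ node (suc (length (labelsF F))) []
standardise-sprout F n lt =
  let agree , top = rank-insert-max (labelsF F) [] (sym (++-identityʳ (labelsF F))) (labelsF-∷ʳ F _) lt
  in trans (mapLabF-++ _ F _) (cong₂ (λ F′ m → F′ ∷ʳ node m []) (mapLabF-cong F agree) top)

standardise-graft : ∀ pre r cs post n → let L₀ = labelsF (pre ++ node r cs ∷ post) in All (_< n) L₀ →
  standardise (pre ∷ʳ node r (cs ∷ʳ node n post)) ≡
  mapLabF (rank L₀) pre ∷ʳ node (rank L₀ r) (mapLabF (rank L₀) cs ∷ʳ node (suc (length L₀)) (mapLabF (rank L₀) post))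
standardise-graft pre r cs post n lt =
  let agree , top = rank-insert-max (labelsF pre ++ r ∷ labelsF cs) (labelsF post)
                      (labelsF-split pre r cs post) (labelsF-graft pre r cs n post) lt
      agree-pre , agree-r , agree-cs , agree-post = All-labelsF-split pre r cs post agree
  in trans (mapLabF-graft _ pre r cs n post)
       (cong₂ (λ F′ T → F′ ∷ʳ T) (mapLabF-cong pre agree-pre)
         (cong₂ node agree-r (cong₂ (λ cs′ T → cs′ ∷ʳ T) (mapLabF-cong cs agree-cs)
           (cong₂ node top (mapLabF-cong post agree-post)))))

plusNew-replicate : ∀ {k F} → G (replicate k plus) F → G (replicate (suc k) plus) (F ∷ʳ node (suc k) [])
plusNew-replicate {k} {F} g = subst₂ G (sym (replicate-suc-∷ʳ k plus))
  (cong (λ m → F ∷ʳ node (suc m) []) (length-replicate k)) (plusNew g)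

plusAttach-replicate : ∀ {k} pre r cs post → G (replicate k plus) (pre ++ node r cs ∷ post) →
  G (replicate (suc k) plus) (pre ∷ʳ node r (cs ∷ʳ node (suc k) post))
plusAttach-replicate {k} pre r cs post g = subst₂ G (sym (replicate-suc-∷ʳ k plus))
  (cong (λ m → pre ∷ʳ node r (cs ∷ʳ node (suc m) post)) (length-replicate k)) (plusAttach pre r cs post g)

Grown-standardise : ∀ {F} → Grown F → F ≡ [] ⊎ G (replicate (length (labelsF F)) plus) (standardise F)
Grown-standardise empty = inj₁ refl
Grown-standardise (sprout {F} n lt g) = inj₂
  (subst₂ (λ k F′ → G (replicate k plus) F′)
    (sym (length-insert (labelsF F) [] (sym (++-identityʳ _)) (labelsF-∷ʳ F _)))
    (sym (standardise-sprout F n lt)) step)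
  where
  step : G (replicate (suc (length (labelsF F))) plus) (standardise F ∷ʳ node (suc (length (labelsF F))) [])
  step with Grown-standardise g
  ... | inj₁ refl = base plus
  ... | inj₂ G-F  = plusNew-replicate G-F
Grown-standardise (graft pre r cs post n lt g) = inj₂
  (subst₂ (λ k F′ → G (replicate k plus) F′)
    (sym (length-insert _ (labelsF post) (labelsF-split pre r cs post) (labelsF-graft pre r cs n post)))
    (sym (standardise-graft pre r cs post n lt)) step)
  where
  L₀ = labelsF (pre ++ node r cs ∷ post)
  f = rank L₀
  step : G (replicate (suc (length L₀)) plus)
           (mapLabF f pre ∷ʳ node (f r) (mapLabF f cs ∷ʳ node (suc (length L₀)) (mapLabF f post)))
  step with Grown-standardise g
  ... | inj₁ F≡[] = case ++-conicalʳ pre _ F≡[] of λ ()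
  ... | inj₂ G-F  = plusAttach-replicate (mapLabF f pre) (f r) (mapLabF f cs) (mapLabF f post)
                      (subst (G _) (mapLabF-++ f pre (node r cs ∷ post)) G-F)

G⁰∪1-standardise : ∀ {F} → Grown F → G⁰∪1 (standardise F)
G⁰∪1-standardise {[]} _ = inj₁ refl
G⁰∪1-standardise {node _ _ ∷ _} g with Grown-standardise g
... | inj₁ ()
... | inj₂ G-F = inj₂ (_ , s≤s z≤n , G-F)

mainTheorem4 : (T : Defs.Forest) → G⁰∪1 T → (T ≡ [] ⊎ length T ≡ 1) →
    (v : ℕ → Bool) → Admissible T v → G⁰∪1 (Roo v T)
mainTheorem4 _ (inj₁ refl) _ _ _ = inj₁ refl
mainTheorem4 T (inj₂ (n , _ , g)) _ v _ =
  G⁰∪1-standardise (Grown-rooF v (proj₁ (G-plus⇒Grown g (replicate⁺ n refl))))
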